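{- Let $\lambda$ be a nonzero real number. For all integers $m,n\ge 0$, $$\mathrm{Bel}_{n+m,\lambda}(t)=\sum_{k=0}^{m}\sum_{l=0}^{n}(1)_{k,\lambda}{m \brace k}_{\lambda}\binom{n}{l}t^{k}\,F_{n-l,\lambda}^{(k)}(-\lambda t,k-m\lambda)\,\mathrm{Bel}_{l,\lambda}(t).$$
   Context: For nonzero real $\lambda$, the degenerate falling factorial is $(x)_{0,\lambda}=1$, $(x)_{n,\lambda}=x(x-\lambda)\cdots(x-(n-1)\lambda)$ for $n\ge1$, and the degenerate exponential is $e_{\lambda}^{x}(t)=(1+\lambda t)^{x/\lambda}=\sum_{k\ge0}(x)_{k,\lambda}\frac{t^k}{k!}$, with $e_\lambda(t)=e_\lambda^1(t)$. The degenerate Stirling numbers of the second kind ${n \brace k}_{\lambda}$ are defined by $\frac{1}{k!}(e_{\lambda}(t)-1)^{k}=\sum_{n\ge k}{n \brace k}_{\lambda}\frac{t^{n}}{n!}$ for $k\ge0$. The fully degenerate Bell polynomials are $\mathrm{Bel}_{n,\lambda}(x)=\sum_{k=0}^{n}{n \brace k}_{\lambda}(1)_{k,\lambda}x^{k}$, equivalently $e_{\lambda}\big(x(e_{\lambda}(s)-1)\big)=\sum_{n\ge0}\mathrm{Bel}_{n,\lambda}(x)\frac{s^n}{n!}$. The two-variable degenerate Fubini polynomials of order $\alpha$ are defined by $\Big(\frac{1}{1-x(e_{\lambda}(s)-1)}\Big)^{\alpha}e_{\lambda}^{y}(s)=\sum_{n\ge0}F_{n,\lambda}^{(\alpha)}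(x,y)\frac{s^{n}}{n!}$.
   Formalization: The parameter λ is a nonzero rational rather than a nonzero real number, and the variable t of the polynomials also ranges over the rationals. -}

module Defs where

open import Data.Nat as ℕ using (ℕ; zero; suc; _∸_; _!)
open import Data.Nat.Properties using (_!≢0)
open import Data.Nat.Combinatorics using (_C_)
open import Data.Integer using (+_)
open import Data.Rational using (ℚ; 0ℚ; 1ℚ; _+_; _*_; _-_; _/_)

ι : ℕ → ℚ
ι n = (+ n) / 1

_^ᵠ_ : ℚ → ℕ → ℚ
x ^ᵠ zero  = 1ℚ
x ^ᵠ suc k = (x ^ᵠ k) * x

sumTo : ℕ → (ℕ → ℚ) → ℚ
sumTo zero    f = f 0
sumTo (suc n) f = sumTo n f + f (suc n)

ff : (lam x : ℚ) → ℕ → ℚ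
ff lam x zero    = 1ℚ
ff lam x (suc n) = ff lam x n * (x - ι n * lam)

-- Exponential formal power series over ℚ:
-- a : EGF represents  Σ_n a n · sⁿ / n!
EGF : Set
EGF = ℕ → ℚ

_⊛_ : EGF → EGF → EGF
(a ⊛ b) n = sumTo n (λ i → ι (n C i) * (a i * b (n ∸ i)))

oneS : EGF
oneS zero    = 1ℚ
oneS (suc _) = 0ℚ

scaleS : ℚ → EGF → EGF
scaleS c a n = c * a n

powS : EGF → ℕ → EGF
powS a zero    = oneS
powS a (suc k) = powS a k ⊛ a

-- 1 / (1 - u) = Σ_j u^j, for a series u with zero constant term
-- (only u^0,...,u^n contribute to the n-th coefficient)
geomS : EGF → EGF
geomS u n = sumTo n (λ j → powS u j n)

expλ : (lam x : ℚ) → EGF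
expλ lam x = ff lam x

expλm1 : (lam : ℚ) → EGF
expλm1 lam zero    = 0ℚ
expλm1 lam (suc n) = expλ lam 1ℚ (suc n)

stirling2 : (lam : ℚ) (n k : ℕ) → ℚ
stirling2 lam n k = powS (expλm1 lam) k n * ((+ 1) / (k !))
  where instance _ = k !≢0

bel : (lam : ℚ) (n : ℕ) (x : ℚ) → ℚ
bel lam n x = sumTo n (λ k → stirling2 lam n k * ff lam 1ℚ k * (x ^ᵠ k))

fubini : (lam : ℚ) (α : ℕ) (n : ℕ) (x y : ℚ) → ℚ
fubini lam α n x y = (powS (geomS (scaleS x (expλm1 lam))) α ⊛ expλ lam y) n

-- Write u = e_λ(s) - 1, G = 1/(1 + λt u), B = e_λ(t u) = Σ Bel_{n,λ}(t) sⁿ/n! and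
-- T_{j,z} = B G^j e_λ^z(s), whose n-th coefficient is Σ_l C(n,l) F^{(j)}_{n-l,λ}(-λt, z) Bel_{l,λ}(t).
-- The right-hand side of the theorem is the n-th coefficient of
-- H_m = Σ_k (1)_{k,λ} S_λ(m,k) t^k T_{k,k-mλ} and the left-hand side is that of B^{(m)};
-- since H_0 = B, it suffices to show H_m' = H_{m+1}.
-- From (1 + λt u) G = 1, (1 + λt u) B' = t u' B and u' = e_λ^{1-λ} one gets B' = t e_λ^{1-λ} G B and
-- G' = -λt e_λ^{1-λ} G², hence T_{j,z}' = (t - jλt) T_{j+1,z+1-λ} + z T_{j,z-λ}; the recurrence
-- S_λ(m+1,k) = S_λ(m,k-1) + (k - mλ) S_λ(m,k), which comes from (1 + λs) u' = 1 + u, then regroups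
-- the terms of H_m' into H_{m+1}.
module Submission where

open import Defs
open import Data.Nat using (ℕ; _+_; _∸_)
open import Data.Nat.Combinatorics using (_C_)
open import Data.Rational using (ℚ; 0ℚ; 1ℚ; _*_; _-_; -_)
open import Relation.Binary.PropositionalEquality using (_≡_; _≢_)

open import Algebra.Bundles using (CommutativeRing)
import Algebra.Construct.Pointwise ℕ as Pointwise
import Algebra.Properties.CommutativeSemigroup as CommutativeSemigroupProperties
import Algebra.Properties.Ring as RingProperties
open import Algebra.Structures using (IsCommutativeRing)
open import Data.Integer as ℤ using (+_)
import Data.Integer.Properties as ℤ
open import Data.Nat as ℕ using (zero; suc; _≤_; _<_; z≤n; s≤s; _!)
open import Data.Nat.Combinatorics using (nCk+nC[k+1]≡[n+1]C[k+1]; k>n⇒nCk≡0)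
import Data.Nat.Properties as ℕ
open import Data.Nat.Properties using (_!≢0)
open import Data.Product using (_,_)
open import Data.Rational as ℚ using (_/_; toℚᵘ) renaming (_+_ to _+ℚ_)
import Data.Rational.Properties as ℚ
open import Data.Rational.Unnormalised as ℚᵘ using (mkℚᵘ; *≡*)
import Data.Rational.Unnormalised.Properties as ℚᵘ
open import Level using (0ℓ)
open import Relation.Binary.PropositionalEquality
  using (_≗_; refl; sym; trans; cong; cong₂; module ≡-Reasoning)
import Relation.Binary.Reasoning.Setoid as SetoidReasoning
open import Relation.Nullary using (yes; no)
open import Relation.Nullary.Decidable using (dec⇒maybe)
open import Tactic.RingSolver using (solve-∀)
open import Tactic.RingSolver.Core.AlmostCommutativeRing
  using (AlmostCommutativeRing; fromCommutativeRing)

-- Natural numbers and factorials in ℚ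

ℚ-ring : AlmostCommutativeRing 0ℓ 0ℓ
ℚ-ring = fromCommutativeRing ℚ.+-*-commutativeRing (λ x → dec⇒maybe (0ℚ ℚ.≟ x))

ι-suc : ∀ n → ι (suc n) ≡ 1ℚ +ℚ ι n
ι-suc n = ℚ.toℚᵘ-injective (begin
  toℚᵘ (ι (suc n))                ≈⟨ ℚ.toℚᵘ-fromℚᵘ (mkℚᵘ (+ suc n) 0) ⟩
  mkℚᵘ (+ suc n) 0                ≈⟨ *≡* cross-multiplied ⟩
  mkℚᵘ (+ 1) 0 ℚᵘ.+ mkℚᵘ (+ n) 0  ≈⟨ ℚᵘ.+-cong (ℚ.toℚᵘ-fromℚᵘ (mkℚᵘ (+ 1) 0)) (ℚ.toℚᵘ-fromℚᵘ (mkℚᵘ (+ n) 0)) ⟨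
  toℚᵘ 1ℚ ℚᵘ.+ toℚᵘ (ι n)         ≈⟨ ℚ.toℚᵘ-homo-+ 1ℚ (ι n) ⟨
  toℚᵘ (1ℚ +ℚ ι n)                ∎)
  where
  open ℚᵘ.≃-Reasoning
  cross-multiplied : + suc n ℤ.* + 1 ≡ (+ 1 ℤ.+ + n ℤ.* + 1) ℤ.* + 1
  cross-multiplied = trans (ℤ.*-identityʳ (+ suc n))
                           (sym (trans (ℤ.*-identityʳ _) (cong (ℤ._+_ (+ 1)) (ℤ.*-identityʳ (+ n)))))

ι-+ : ∀ m n → ι (m + n) ≡ ι m +ℚ ι n
ι-+ zero    n = sym (ℚ.+-identityˡ (ι n))
ι-+ (suc m) n = begin
  ι (suc (m + n))        ≡⟨ ι-suc (m + n) ⟩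
  1ℚ +ℚ ι (m + n)        ≡⟨ cong (1ℚ +ℚ_) (ι-+ m n) ⟩
  1ℚ +ℚ (ι m +ℚ ι n)     ≡⟨ ℚ.+-assoc 1ℚ (ι m) (ι n) ⟨
  (1ℚ +ℚ ι m) +ℚ ι n     ≡⟨ cong (_+ℚ ι n) (ι-suc m) ⟨
  ι (suc m) +ℚ ι n       ∎
  where open ≡-Reasoning

ι-* : ∀ m n → ι (m ℕ.* n) ≡ ι m * ι n
ι-* zero    n = sym (ℚ.*-zeroˡ (ι n))
ι-* (suc m) n = begin
  ι (n + m ℕ.* n)        ≡⟨ ι-+ n (m ℕ.* n) ⟩
  ι n +ℚ ι (m ℕ.* n)     ≡⟨ cong (ι n +ℚ_) (ι-* m n) ⟩
  ι n +ℚ ι m * ι n       ≡⟨ cong (_+ℚ ι m * ι n) (ℚ.*-identityˡ (ι n)) ⟨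
  1ℚ * ι n +ℚ ι m * ι n  ≡⟨ ℚ.*-distribʳ-+ (ι n) 1ℚ (ι m) ⟨
  (1ℚ +ℚ ι m) * ι n      ≡⟨ cong (_* ι n) (ι-suc m) ⟨
  ι (suc m) * ι n        ∎
  where open ≡-Reasoning

_!⁻¹ : ℕ → ℚ
k !⁻¹ = (+ 1 / k !) {{k !≢0}}

ι-*-1/ : ∀ n .{{_ : ℕ.NonZero n}} → ι n * (+ 1 / n) ≡ 1ℚ
ι-*-1/ (suc n) = ℚ.toℚᵘ-injective (begin
  toℚᵘ (ι (suc n) * (+ 1 / suc n))
    ≈⟨ ℚ.toℚᵘ-homo-* (ι (suc n)) (+ 1 / suc n) ⟩
  toℚᵘ (ι (suc n)) ℚᵘ.* toℚᵘ (+ 1 / suc n)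
    ≈⟨ ℚᵘ.*-cong (ℚ.toℚᵘ-fromℚᵘ (mkℚᵘ (+ suc n) 0)) (ℚ.toℚᵘ-fromℚᵘ (mkℚᵘ (+ 1) n)) ⟩
  mkℚᵘ (+ suc n) 0 ℚᵘ.* mkℚᵘ (+ 1) n
    ≈⟨ *≡* cross-multiplied ⟩
  toℚᵘ 1ℚ
    ∎)
  where
  open ℚᵘ.≃-Reasoning
  cross-multiplied : (+ suc n ℤ.* + 1) ℤ.* + 1 ≡ + 1 ℤ.* + (1 ℕ.* suc n)
  cross-multiplied = trans (trans (ℤ.*-identityʳ _) (ℤ.*-identityʳ _))
                           (sym (trans (ℤ.*-identityˡ _) (cong +_ (ℕ.*-identityˡ (suc n)))))

ι-!-*-!⁻¹ : ∀ k → ι (k !) * k !⁻¹ ≡ 1ℚ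
ι-!-*-!⁻¹ k = ι-*-1/ (k !) {{k !≢0}}

ι-suc-*-!⁻¹ : ∀ k → ι (suc k) * suc k !⁻¹ ≡ k !⁻¹
ι-suc-*-!⁻¹ k = begin
  ι (suc k) * suc k !⁻¹
    ≡⟨ ℚ.*-identityˡ _ ⟨
  1ℚ * (ι (suc k) * suc k !⁻¹)
    ≡⟨ cong (_* (ι (suc k) * suc k !⁻¹)) (ι-!-*-!⁻¹ k) ⟨
  (ι (k !) * k !⁻¹) * (ι (suc k) * suc k !⁻¹)
    ≡⟨ rearrange (ι (k !)) (k !⁻¹) (ι (suc k)) (suc k !⁻¹) ⟩
  ((ι (suc k) * ι (k !)) * suc k !⁻¹) * k !⁻¹
    ≡⟨ cong (λ x → (x * suc k !⁻¹) * k !⁻¹) (ι-* (suc k) (k !)) ⟨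
  (ι (suc k !) * suc k !⁻¹) * k !⁻¹
    ≡⟨ cong (_* k !⁻¹) (ι-!-*-!⁻¹ (suc k)) ⟩
  1ℚ * k !⁻¹
    ≡⟨ ℚ.*-identityˡ (k !⁻¹) ⟩
  k !⁻¹
    ∎
  where
  open ≡-Reasoning
  rearrange : ∀ a b c d → (a * b) * (c * d) ≡ ((c * a) * d) * b
  rearrange = solve-∀ ℚ-ring

-- Finite sums

sumTo-cong : ∀ n {f g : ℕ → ℚ} → (∀ i → i ≤ n → f i ≡ g i) → sumTo n f ≡ sumTo n g
sumTo-cong zero    f≡g = f≡g 0 z≤n
sumTo-cong (suc n) f≡g =
  cong₂ _+ℚ_ (sumTo-cong n (λ i i≤n → f≡g i (ℕ.m≤n⇒m≤1+n i≤n))) (f≡g (suc n) ℕ.≤-refl)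

sumTo-zero : ∀ n {f : ℕ → ℚ} → (∀ i → i ≤ n → f i ≡ 0ℚ) → sumTo n f ≡ 0ℚ
sumTo-zero n f≡0 = trans (sumTo-cong n f≡0) (sumTo-const-0 n)
  where
  sumTo-const-0 : ∀ n → sumTo n (λ _ → 0ℚ) ≡ 0ℚ
  sumTo-const-0 zero    = refl
  sumTo-const-0 (suc n) = cong (_+ℚ 0ℚ) (sumTo-const-0 n)

sumTo-distrib-+ : ∀ n (f g : ℕ → ℚ) → sumTo n (λ i → f i +ℚ g i) ≡ sumTo n f +ℚ sumTo n g
sumTo-distrib-+ zero    f g = refl
sumTo-distrib-+ (suc n) f g = trans (cong (_+ℚ (f (suc n) +ℚ g (suc n))) (sumTo-distrib-+ n f g))
                                    (interchange (sumTo n f) (sumTo n g) (f (suc n)) (g (suc n)))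
  where
  interchange : ∀ a b c d → (a +ℚ b) +ℚ (c +ℚ d) ≡ (a +ℚ c) +ℚ (b +ℚ d)
  interchange = solve-∀ ℚ-ring

sumTo-*-distribˡ : ∀ n c (f : ℕ → ℚ) → sumTo n (λ i → c * f i) ≡ c * sumTo n f
sumTo-*-distribˡ zero    c f = refl
sumTo-*-distribˡ (suc n) c f = trans (cong (_+ℚ c * f (suc n)) (sumTo-*-distribˡ n c f))
                                     (sym (ℚ.*-distribˡ-+ c (sumTo n f) (f (suc n))))

sumTo-suc : ∀ n (f : ℕ → ℚ) → sumTo (suc n) f ≡ f 0 +ℚ sumTo n (λ i → f (suc i))
sumTo-suc zero    f = refl
sumTo-suc (suc n) f = trans (cong (_+ℚ f (suc (suc n))) (sumTo-suc n f))
                            (ℚ.+-assoc (f 0) (sumTo n (λ i → f (suc i))) (f (suc (suc n))))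

sumTo-+-vanishing : ∀ d n {f : ℕ → ℚ} → (∀ j → n < j → f j ≡ 0ℚ) → sumTo (d + n) f ≡ sumTo n f
sumTo-+-vanishing zero    n f≡0 = refl
sumTo-+-vanishing (suc d) n f≡0 =
  trans (cong₂ _+ℚ_ (sumTo-+-vanishing d n f≡0) (f≡0 (suc (d + n)) (s≤s (ℕ.m≤n+m n d))))
        (ℚ.+-identityʳ (sumTo n _))

-- The ring of exponential generating functions

D : EGF → EGF
D a n = a (suc n)

_⊕_ : EGF → EGF → EGF
(a ⊕ b) n = a n +ℚ b n

⊖_ : EGF → EGF
(⊖ a) n = - a n

zeroS : EGF
zeroS _ = 0ℚ

infixl 6 _⊕_

_C′_ : ℕ → ℕ → ℕ
n C′ zero  = 0
n C′ suc i = n C i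

pascal : ∀ n i → suc n C i ≡ n C i + n C′ i
pascal n zero    = refl
pascal n (suc i) = trans (sym (nCk+nC[k+1]≡[n+1]C[k+1] n i)) (ℕ.+-comm (n C i) (n C suc i))

D-⊛ : ∀ a b → D (a ⊛ b) ≗ D a ⊛ b ⊕ a ⊛ D b
D-⊛ a b n = begin
  sumTo (suc n) (λ i → ι (suc n C i) * X i)
    ≡⟨ sumTo-cong (suc n) (λ i _ → split-binomial i) ⟩
  sumTo (suc n) (λ i → ι (n C i) * X i +ℚ ι (n C′ i) * X i)
    ≡⟨ sumTo-distrib-+ (suc n) (λ i → ι (n C i) * X i) (λ i → ι (n C′ i) * X i) ⟩
  sumTo (suc n) (λ i → ι (n C i) * X i) +ℚ sumTo (suc n) (λ i → ι (n C′ i) * X i)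
    ≡⟨ cong₂ _+ℚ_ a-⊛-D-b D-a-⊛-b ⟩
  (a ⊛ D b) n +ℚ (D a ⊛ b) n
    ≡⟨ ℚ.+-comm ((a ⊛ D b) n) ((D a ⊛ b) n) ⟩
  (D a ⊛ b) n +ℚ (a ⊛ D b) n ∎
  where
  open ≡-Reasoning
  X : ℕ → ℚ
  X i = a i * b (suc n ∸ i)
  split-binomial : ∀ i → ι (suc n C i) * X i ≡ ι (n C i) * X i +ℚ ι (n C′ i) * X i
  split-binomial i = begin
    ι (suc n C i) * X i                ≡⟨ cong (λ k → ι k * X i) (pascal n i) ⟩
    ι (n C i + n C′ i) * X i           ≡⟨ cong (_* X i) (ι-+ (n C i) (n C′ i)) ⟩
    (ι (n C i) +ℚ ι (n C′ i)) * X i    ≡⟨ ℚ.*-distribʳ-+ (X i) (ι (n C i)) (ι (n C′ i)) ⟩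
    ι (n C i) * X i +ℚ ι (n C′ i) * X i ∎
  a-⊛-D-b : sumTo (suc n) (λ i → ι (n C i) * X i) ≡ (a ⊛ D b) n
  a-⊛-D-b = begin
    sumTo n (λ i → ι (n C i) * X i) +ℚ ι (n C suc n) * X (suc n)
      ≡⟨ cong (λ k → sumTo n (λ i → ι (n C i) * X i) +ℚ ι k * X (suc n)) (k>n⇒nCk≡0 (ℕ.n<1+n n)) ⟩
    sumTo n (λ i → ι (n C i) * X i) +ℚ 0ℚ * X (suc n)
      ≡⟨ cong (sumTo n (λ i → ι (n C i) * X i) +ℚ_) (ℚ.*-zeroˡ (X (suc n))) ⟩
    sumTo n (λ i → ι (n C i) * X i) +ℚ 0ℚ
      ≡⟨ ℚ.+-identityʳ _ ⟩
    sumTo n (λ i → ι (n C i) * X i)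
      ≡⟨ sumTo-cong n (λ i i≤n → cong (λ k → ι (n C i) * (a i * b k)) (ℕ.+-∸-assoc 1 i≤n)) ⟩
    (a ⊛ D b) n ∎
  D-a-⊛-b : sumTo (suc n) (λ i → ι (n C′ i) * X i) ≡ (D a ⊛ b) n
  D-a-⊛-b = begin
    sumTo (suc n) (λ i → ι (n C′ i) * X i)     ≡⟨ sumTo-suc n (λ i → ι (n C′ i) * X i) ⟩
    0ℚ * X 0 +ℚ (D a ⊛ b) n                   ≡⟨ cong (_+ℚ (D a ⊛ b) n) (ℚ.*-zeroˡ (X 0)) ⟩
    0ℚ +ℚ (D a ⊛ b) n                         ≡⟨ ℚ.+-identityˡ _ ⟩
    (D a ⊛ b) n                               ∎

⊛-congˡ-≤ : ∀ n a {b b′} → (∀ i → i ≤ n → b i ≡ b′ i) → (a ⊛ b) n ≡ (a ⊛ b′) n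
⊛-congˡ-≤ n a b≡b′ =
  sumTo-cong n (λ i _ → cong (λ x → ι (n C i) * (a i * x)) (b≡b′ (n ∸ i) (ℕ.m∸n≤m n i)))

⊛-congˡ : ∀ a {b b′} → b ≗ b′ → a ⊛ b ≗ a ⊛ b′
⊛-congˡ a b≗b′ n = ⊛-congˡ-≤ n a (λ i _ → b≗b′ i)

⊛-congʳ : ∀ {a a′} b → a ≗ a′ → a ⊛ b ≗ a′ ⊛ b
⊛-congʳ b a≗a′ n = sumTo-cong n (λ i _ → cong (λ x → ι (n C i) * (x * b (n ∸ i))) (a≗a′ i))

⊛-zeroˡ : ∀ b → zeroS ⊛ b ≗ zeroS
⊛-zeroˡ b n = sumTo-zero n (λ i _ → trans (cong (ι (n C i) *_) (ℚ.*-zeroˡ (b (n ∸ i))))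
                                          (ℚ.*-zeroʳ (ι (n C i))))

⊛-distribʳ : ∀ c a b → (a ⊕ b) ⊛ c ≗ a ⊛ c ⊕ b ⊛ c
⊛-distribʳ c a b n =
  trans (sumTo-cong n (λ i _ → distrib (ι (n C i)) (a i) (b i) (c (n ∸ i))))
        (sumTo-distrib-+ n (λ i → ι (n C i) * (a i * c (n ∸ i))) (λ i → ι (n C i) * (b i * c (n ∸ i))))
  where
  distrib : ∀ k x y z → k * ((x +ℚ y) * z) ≡ k * (x * z) +ℚ k * (y * z)
  distrib = solve-∀ ℚ-ring

⊛-scaleˡ : ∀ c a b → scaleS c a ⊛ b ≗ scaleS c (a ⊛ b)
⊛-scaleˡ c a b n =
  trans (sumTo-cong n (λ i _ → pull-out (ι (n C i)) c (a i) (b (n ∸ i))))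
        (sumTo-*-distribˡ n c (λ i → ι (n C i) * (a i * b (n ∸ i))))
  where
  pull-out : ∀ k c x y → k * ((c * x) * y) ≡ c * (k * (x * y))
  pull-out = solve-∀ ℚ-ring

⊛-comm : ∀ a b → a ⊛ b ≗ b ⊛ a
⊛-comm a b zero    = trans (ℚ.*-identityˡ _) (trans (ℚ.*-comm (a 0) (b 0)) (sym (ℚ.*-identityˡ _)))
⊛-comm a b (suc n) = begin
  (a ⊛ b) (suc n)              ≡⟨ D-⊛ a b n ⟩
  (D a ⊛ b) n +ℚ (a ⊛ D b) n   ≡⟨ cong₂ _+ℚ_ (⊛-comm (D a) b n) (⊛-comm a (D b) n) ⟩
  (b ⊛ D a) n +ℚ (D b ⊛ a) n   ≡⟨ ℚ.+-comm ((b ⊛ D a) n) ((D b ⊛ a) n) ⟩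
  (D b ⊛ a) n +ℚ (b ⊛ D a) n   ≡⟨ D-⊛ b a n ⟨
  (b ⊛ a) (suc n)              ∎
  where open ≡-Reasoning

⊛-distribˡ : ∀ a b c → a ⊛ (b ⊕ c) ≗ a ⊛ b ⊕ a ⊛ c
⊛-distribˡ a b c n = begin
  (a ⊛ (b ⊕ c)) n              ≡⟨ ⊛-comm a (b ⊕ c) n ⟩
  ((b ⊕ c) ⊛ a) n              ≡⟨ ⊛-distribʳ a b c n ⟩
  (b ⊛ a) n +ℚ (c ⊛ a) n       ≡⟨ cong₂ _+ℚ_ (⊛-comm b a n) (⊛-comm c a n) ⟩
  (a ⊛ b) n +ℚ (a ⊛ c) n       ∎
  where open ≡-Reasoning

⊛-identityˡ : ∀ b → oneS ⊛ b ≗ b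
⊛-identityˡ b zero    = trans (ℚ.*-identityˡ _) (ℚ.*-identityˡ (b 0))
⊛-identityˡ b (suc n) = begin
  (oneS ⊛ b) (suc n)                 ≡⟨ D-⊛ oneS b n ⟩
  (D oneS ⊛ b) n +ℚ (oneS ⊛ D b) n   ≡⟨ cong₂ _+ℚ_ (⊛-zeroˡ b n) (⊛-identityˡ (D b) n) ⟩
  0ℚ +ℚ b (suc n)                    ≡⟨ ℚ.+-identityˡ (b (suc n)) ⟩
  b (suc n)                          ∎
  where open ≡-Reasoning

⊛-assoc : ∀ a b c → (a ⊛ b) ⊛ c ≗ a ⊛ (b ⊛ c)
⊛-assoc a b c zero = begin
  1ℚ * ((1ℚ * (a 0 * b 0)) * c 0)   ≡⟨ ℚ.*-identityˡ ((1ℚ * (a 0 * b 0)) * c 0) ⟩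
  (1ℚ * (a 0 * b 0)) * c 0          ≡⟨ cong (_* c 0) (ℚ.*-identityˡ (a 0 * b 0)) ⟩
  (a 0 * b 0) * c 0                 ≡⟨ ℚ.*-assoc (a 0) (b 0) (c 0) ⟩
  a 0 * (b 0 * c 0)                 ≡⟨ cong (a 0 *_) (ℚ.*-identityˡ (b 0 * c 0)) ⟨
  a 0 * (1ℚ * (b 0 * c 0))          ≡⟨ ℚ.*-identityˡ (a 0 * (1ℚ * (b 0 * c 0))) ⟨
  1ℚ * (a 0 * (1ℚ * (b 0 * c 0)))   ∎
  where open ≡-Reasoning
⊛-assoc a b c (suc n) = begin
  ((a ⊛ b) ⊛ c) (suc n)
    ≡⟨ D-⊛ (a ⊛ b) c n ⟩
  (D (a ⊛ b) ⊛ c) n +ℚ ((a ⊛ b) ⊛ D c) n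
    ≡⟨ cong (_+ℚ ((a ⊛ b) ⊛ D c) n)
            (trans (⊛-congʳ c (D-⊛ a b) n) (⊛-distribʳ c (D a ⊛ b) (a ⊛ D b) n)) ⟩
  (((D a ⊛ b) ⊛ c) n +ℚ ((a ⊛ D b) ⊛ c) n) +ℚ ((a ⊛ b) ⊛ D c) n
    ≡⟨ cong₂ _+ℚ_ (cong₂ _+ℚ_ (⊛-assoc (D a) b c n) (⊛-assoc a (D b) c n)) (⊛-assoc a b (D c) n) ⟩
  ((D a ⊛ (b ⊛ c)) n +ℚ (a ⊛ (D b ⊛ c)) n) +ℚ (a ⊛ (b ⊛ D c)) n
    ≡⟨ ℚ.+-assoc ((D a ⊛ (b ⊛ c)) n) ((a ⊛ (D b ⊛ c)) n) ((a ⊛ (b ⊛ D c)) n) ⟩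
  (D a ⊛ (b ⊛ c)) n +ℚ ((a ⊛ (D b ⊛ c)) n +ℚ (a ⊛ (b ⊛ D c)) n)
    ≡⟨ cong ((D a ⊛ (b ⊛ c)) n +ℚ_)
            (trans (⊛-congˡ a (D-⊛ b c) n) (⊛-distribˡ a (D b ⊛ c) (b ⊛ D c) n)) ⟨
  (D a ⊛ (b ⊛ c)) n +ℚ (a ⊛ D (b ⊛ c)) n
    ≡⟨ D-⊛ a (b ⊛ c) n ⟨
  (a ⊛ (b ⊛ c)) (suc n) ∎
  where open ≡-Reasoning

⊛-isCommutativeRing : IsCommutativeRing _≗_ _⊕_ _⊛_ ⊖_ zeroS oneS
⊛-isCommutativeRing = record
  { isRing = record
    { +-isAbelianGroup = Pointwise.isAbelianGroup ℚ.+-0-isAbelianGroup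
    ; *-cong           = λ {a} {a′} {b} {b′} a≗a′ b≗b′ n →
                           trans (⊛-congʳ b a≗a′ n) (⊛-congˡ a′ b≗b′ n)
    ; *-assoc          = ⊛-assoc
    ; *-identity       = ⊛-identityˡ , λ a n → trans (⊛-comm a oneS n) (⊛-identityˡ a n)
    ; distrib          = ⊛-distribˡ , ⊛-distribʳ
    }
  ; *-comm = ⊛-comm
  }

EGF-commutativeRing : CommutativeRing 0ℓ 0ℓ
EGF-commutativeRing = record { isCommutativeRing = ⊛-isCommutativeRing }

module EGF = CommutativeRing EGF-commutativeRing
module ≗-Reasoning = SetoidReasoning EGF.setoid
open CommutativeSemigroupProperties EGF.*-commutativeSemigroup
  using (xy∙z≈xz∙y; xy∙z≈y∙xz; x∙yz≈y∙xz; x∙yz≈xz∙y; x∙yz≈z∙xy; interchange)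
open RingProperties EGF.ring using (+-cancelʳ)

⊛-scaleʳ : ∀ c a b → a ⊛ scaleS c b ≗ scaleS c (a ⊛ b)
⊛-scaleʳ c a b n = begin
  (a ⊛ scaleS c b) n   ≡⟨ ⊛-comm a (scaleS c b) n ⟩
  (scaleS c b ⊛ a) n   ≡⟨ ⊛-scaleˡ c b a n ⟩
  c * (b ⊛ a) n        ≡⟨ cong (c *_) (⊛-comm b a n) ⟩
  c * (a ⊛ b) n        ∎
  where open ≡-Reasoning

⊕-congˡ : ∀ a {b b′} → b ≗ b′ → a ⊕ b ≗ a ⊕ b′
⊕-congˡ a b≗b′ n = cong (a n +ℚ_) (b≗b′ n)

⊕-congʳ : ∀ {a a′} b → a ≗ a′ → a ⊕ b ≗ a′ ⊕ b
⊕-congʳ b a≗a′ n = cong (_+ℚ b n) (a≗a′ n)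

scaleS-cong : ∀ c {a b} → a ≗ b → scaleS c a ≗ scaleS c b
scaleS-cong c a≗b n = cong (c *_) (a≗b n)

scaleS-scaleS : ∀ a b x → scaleS a (scaleS b x) ≗ scaleS (a * b) x
scaleS-scaleS a b x n = sym (ℚ.*-assoc a b (x n))

X : EGF
X 1 = 1ℚ
X _ = 0ℚ

X-⊛-D : ∀ a n → (X ⊛ D a) n ≡ ι n * a n
X-⊛-D a zero    = trans (ℚ.*-identityˡ (0ℚ * a 1)) (trans (ℚ.*-zeroˡ (a 1)) (sym (ℚ.*-zeroˡ (a 0))))
X-⊛-D a (suc n) = begin
  (X ⊛ D a) (suc n)                    ≡⟨ D-⊛ X (D a) n ⟩
  (D X ⊛ D a) n +ℚ (X ⊛ D (D a)) n     ≡⟨ cong₂ _+ℚ_ (trans (⊛-congʳ (D a) D-X n) (⊛-identityˡ (D a) n))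
                                                      (X-⊛-D (D a) n) ⟩
  a (suc n) +ℚ ι n * a (suc n)         ≡⟨ add-one (ι n) (a (suc n)) ⟩
  (1ℚ +ℚ ι n) * a (suc n)              ≡⟨ cong (_* a (suc n)) (ι-suc n) ⟨
  ι (suc n) * a (suc n)                ∎
  where
  open ≡-Reasoning
  D-X : D X ≗ oneS
  D-X zero    = refl
  D-X (suc _) = refl
  add-one : ∀ c x → x +ℚ c * x ≡ (1ℚ +ℚ c) * x
  add-one = solve-∀ ℚ-ring

-- Powers, and substitution into a series without constant term

powS-vanish : ∀ v → v 0 ≡ 0ℚ → ∀ k n → n < k → powS v k n ≡ 0ℚ
powS-vanish v v₀≡0 (suc k) n (s≤s n≤k) = sumTo-zero n term-vanishes
  where
  term-vanishes : ∀ i → i ≤ n → ι (n C i) * (powS v k i * v (n ∸ i)) ≡ 0ℚ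
  term-vanishes i i≤n with i ℕ.<? k
  ... | yes i<k = begin
    ι (n C i) * (powS v k i * v (n ∸ i))
      ≡⟨ cong (λ x → ι (n C i) * (x * v (n ∸ i))) (powS-vanish v v₀≡0 k i i<k) ⟩
    ι (n C i) * (0ℚ * v (n ∸ i))          ≡⟨ cong (ι (n C i) *_) (ℚ.*-zeroˡ (v (n ∸ i))) ⟩
    ι (n C i) * 0ℚ                        ≡⟨ ℚ.*-zeroʳ (ι (n C i)) ⟩
    0ℚ                                    ∎
    where open ≡-Reasoning
  ... | no i≮k = begin
    ι (n C i) * (powS v k i * v (n ∸ i))  ≡⟨ cong (λ j → ι (n C i) * (powS v k i * v j)) n∸i≡0 ⟩
    ι (n C i) * (powS v k i * v 0)        ≡⟨ cong (λ x → ι (n C i) * (powS v k i * x)) v₀≡0 ⟩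
    ι (n C i) * (powS v k i * 0ℚ)         ≡⟨ cong (ι (n C i) *_) (ℚ.*-zeroʳ (powS v k i)) ⟩
    ι (n C i) * 0ℚ                        ≡⟨ ℚ.*-zeroʳ (ι (n C i)) ⟩
    0ℚ                                    ∎
    where
    open ≡-Reasoning
    n∸i≡0 : n ∸ i ≡ 0
    n∸i≡0 = ℕ.m≤n⇒m∸n≡0 (ℕ.≤-trans n≤k (ℕ.≮⇒≥ i≮k))

D-powS : ∀ v k → D (powS v (suc k)) ≗ scaleS (ι (suc k)) (powS v k ⊛ D v)
D-powS v zero n = begin
  (oneS ⊛ v) (suc n)           ≡⟨ ⊛-identityˡ v (suc n) ⟩
  v (suc n)                    ≡⟨ ⊛-identityˡ (D v) n ⟨
  (oneS ⊛ D v) n               ≡⟨ ℚ.*-identityˡ _ ⟨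
  1ℚ * (oneS ⊛ D v) n          ∎
  where open ≡-Reasoning
D-powS v (suc k) = begin
  D (vᵏ⁺¹ ⊛ v)
    ≈⟨ D-⊛ vᵏ⁺¹ v ⟩
  D vᵏ⁺¹ ⊛ v ⊕ vᵏ⁺¹ ⊛ D v
    ≈⟨ ⊕-congʳ (vᵏ⁺¹ ⊛ D v) (⊛-congʳ v (D-powS v k)) ⟩
  scaleS k+1 (vᵏ ⊛ D v) ⊛ v ⊕ vᵏ⁺¹ ⊛ D v
    ≈⟨ ⊕-congʳ (vᵏ⁺¹ ⊛ D v) (⊛-scaleˡ k+1 (vᵏ ⊛ D v) v) ⟩
  scaleS k+1 ((vᵏ ⊛ D v) ⊛ v) ⊕ vᵏ⁺¹ ⊛ D v
    ≈⟨ ⊕-congʳ (vᵏ⁺¹ ⊛ D v) (scaleS-cong k+1 (xy∙z≈xz∙y vᵏ (D v) v)) ⟩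
  scaleS k+1 (vᵏ⁺¹ ⊛ D v) ⊕ vᵏ⁺¹ ⊛ D v
    ≈⟨ one-more (vᵏ⁺¹ ⊛ D v) ⟩
  scaleS (ι (suc (suc k))) (vᵏ⁺¹ ⊛ D v)
    ∎
  where
  open ≗-Reasoning
  k+1 = ι (suc k)
  vᵏ = powS v k
  vᵏ⁺¹ = powS v (suc k)
  add-one : ∀ c x → c * x +ℚ x ≡ (1ℚ +ℚ c) * x
  add-one = solve-∀ ℚ-ring
  one-more : ∀ a → scaleS (ι (suc k)) a ⊕ a ≗ scaleS (ι (suc (suc k))) a
  one-more a n = trans (add-one (ι (suc k)) (a n)) (cong (_* a n) (sym (ι-suc (suc k))))

-- q(v) for the ordinary power series q = Σ q k xᵏ. Stopping the sum at n is exact when v 0 ≡ 0,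
-- since then vᵏ has no terms below sᵏ.
compose : (ℕ → ℚ) → EGF → EGF
compose q v n = sumTo n (λ k → q k * powS v k n)

shiftˢ : (ℕ → ℚ) → ℕ → ℚ
shiftˢ q zero    = 0ℚ
shiftˢ q (suc k) = q k

derivˢ : (ℕ → ℚ) → ℕ → ℚ
derivˢ q k = ι (suc k) * q (suc k)

shiftˢ-derivˢ : ∀ q k → shiftˢ (derivˢ q) k ≡ ι k * q k
shiftˢ-derivˢ q zero    = sym (ℚ.*-zeroˡ (q 0))
shiftˢ-derivˢ q (suc k) = refl

compose-cong : ∀ {q p} v → (∀ k → q k ≡ p k) → compose q v ≗ compose p v
compose-cong v q≡p n = sumTo-cong n (λ k _ → cong (_* powS v k n) (q≡p k))

compose-+ : ∀ q p v → compose (λ k → q k +ℚ p k) v ≗ compose q v ⊕ compose p v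
compose-+ q p v n = trans (sumTo-cong n (λ k _ → ℚ.*-distribʳ-+ (powS v k n) (q k) (p k)))
                          (sumTo-distrib-+ n (λ k → q k * powS v k n) (λ k → p k * powS v k n))

compose-scale : ∀ c q v → compose (λ k → c * q k) v ≗ scaleS c (compose q v)
compose-scale c q v n = trans (sumTo-cong n (λ k _ → ℚ.*-assoc c (q k) (powS v k n)))
                              (sumTo-*-distribˡ n c (λ k → q k * powS v k n))

compose-oneS : ∀ v → compose oneS v ≗ oneS
compose-oneS v zero    = ℚ.*-identityˡ 1ℚ
compose-oneS v (suc n) = begin
  compose oneS v (suc n)
    ≡⟨ sumTo-suc n (λ k → oneS k * powS v k (suc n)) ⟩
  1ℚ * 0ℚ +ℚ sumTo n (λ k → 0ℚ * powS v (suc k) (suc n))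
    ≡⟨ cong₂ _+ℚ_ (ℚ.*-zeroʳ 1ℚ) (sumTo-zero n (λ k _ → ℚ.*-zeroˡ (powS v (suc k) (suc n)))) ⟩
  0ℚ +ℚ 0ℚ
    ≡⟨⟩
  0ℚ
    ∎
  where open ≡-Reasoning

module _ (v : EGF) (v₀≡0 : v 0 ≡ 0ℚ) where

  compose-pad : ∀ q d n → sumTo (d + n) (λ k → q k * powS v k n) ≡ compose q v n
  compose-pad q d n = sumTo-+-vanishing d n (λ k n<k →
    trans (cong (q k *_) (powS-vanish v v₀≡0 k n n<k)) (ℚ.*-zeroʳ (q k)))

  ⊛-compose : ∀ q a n → (a ⊛ compose q v) n ≡ sumTo n (λ k → q k * (a ⊛ powS v k) n)
  ⊛-compose q a n = trans (⊛-congˡ-≤ n a truncate) (⊛-partial n)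
    where
    partial : ℕ → EGF
    partial N i = sumTo N (λ k → q k * powS v k i)
    truncate : ∀ i → i ≤ n → compose q v i ≡ partial n i
    truncate i i≤n = sym (trans (cong (λ N → partial N i) (sym (ℕ.m∸n+n≡m i≤n))) (compose-pad q (n ∸ i) i))
    ⊛-partial : ∀ N → (a ⊛ partial N) n ≡ sumTo N (λ k → q k * (a ⊛ powS v k) n)
    ⊛-partial zero    = ⊛-scaleʳ (q 0) a (powS v 0) n
    ⊛-partial (suc N) = trans (⊛-distribˡ a (partial N) (scaleS (q (suc N)) (powS v (suc N))) n)
                              (cong₂ _+ℚ_ (⊛-partial N) (⊛-scaleʳ (q (suc N)) a (powS v (suc N)) n))

  compose-shift : ∀ q → v ⊛ compose q v ≗ compose (shiftˢ q) v
  compose-shift q n = begin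
    (v ⊛ compose q v) n
      ≡⟨ ⊛-compose q v n ⟩
    sumTo n (λ k → q k * (v ⊛ powS v k) n)
      ≡⟨ sumTo-cong n (λ k _ → cong (q k *_) (⊛-comm v (powS v k) n)) ⟩
    Σvᵏ⁺¹
      ≡⟨ ℚ.+-identityˡ Σvᵏ⁺¹ ⟨
    0ℚ +ℚ Σvᵏ⁺¹
      ≡⟨ cong (_+ℚ Σvᵏ⁺¹) (ℚ.*-zeroˡ (oneS n)) ⟨
    0ℚ * oneS n +ℚ Σvᵏ⁺¹
      ≡⟨ sumTo-suc n (λ k → shiftˢ q k * powS v k n) ⟨
    sumTo (1 + n) (λ k → shiftˢ q k * powS v k n)
      ≡⟨ compose-pad (shiftˢ q) 1 n ⟩
    compose (shiftˢ q) v n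
      ∎
    where
    open ≡-Reasoning
    Σvᵏ⁺¹ = sumTo n (λ k → q k * powS v (suc k) n)

  D-compose : ∀ q → D (compose q v) ≗ D v ⊛ compose (derivˢ q) v
  D-compose q n = begin
    compose q v (suc n)
      ≡⟨ sumTo-suc n (λ k → q k * powS v k (suc n)) ⟩
    q 0 * 0ℚ +ℚ sumTo n (λ k → q (suc k) * powS v (suc k) (suc n))
      ≡⟨ cong (_+ℚ sumTo n (λ k → q (suc k) * powS v (suc k) (suc n))) (ℚ.*-zeroʳ (q 0)) ⟩
    0ℚ +ℚ sumTo n (λ k → q (suc k) * powS v (suc k) (suc n))
      ≡⟨ ℚ.+-identityˡ _ ⟩
    sumTo n (λ k → q (suc k) * powS v (suc k) (suc n))
      ≡⟨ sumTo-cong n (λ k _ → chain-rule k) ⟩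
    sumTo n (λ k → derivˢ q k * (D v ⊛ powS v k) n)
      ≡⟨ ⊛-compose (derivˢ q) (D v) n ⟨
    (D v ⊛ compose (derivˢ q) v) n ∎
    where
    open ≡-Reasoning
    rearrange : ∀ a b c → a * (b * c) ≡ (b * a) * c
    rearrange = solve-∀ ℚ-ring
    chain-rule : ∀ k → q (suc k) * powS v (suc k) (suc n) ≡ derivˢ q k * (D v ⊛ powS v k) n
    chain-rule k = begin
      q (suc k) * powS v (suc k) (suc n)
        ≡⟨ cong (q (suc k) *_) (D-powS v k n) ⟩
      q (suc k) * (ι (suc k) * (powS v k ⊛ D v) n)
        ≡⟨ cong (λ x → q (suc k) * (ι (suc k) * x)) (⊛-comm (powS v k) (D v) n) ⟩
      q (suc k) * (ι (suc k) * (D v ⊛ powS v k) n)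
        ≡⟨ rearrange (q (suc k)) (ι (suc k)) ((D v ⊛ powS v k) n) ⟩
      derivˢ q k * (D v ⊛ powS v k) n
        ∎

  geomS-compose : geomS v ≗ compose (λ _ → 1ℚ) v
  geomS-compose n = sumTo-cong n (λ k _ → sym (ℚ.*-identityˡ (powS v k n)))

  geomS-unfold : geomS v ≗ oneS ⊕ v ⊛ geomS v
  geomS-unfold = begin
    geomS v                                      ≈⟨ geomS-compose ⟩
    compose 1s v                                 ≈⟨ compose-cong v one≡δ+shift ⟩
    compose (λ k → oneS k +ℚ shiftˢ 1s k) v      ≈⟨ compose-+ oneS (shiftˢ 1s) v ⟩
    compose oneS v ⊕ compose (shiftˢ 1s) v       ≈⟨ EGF.+-cong (compose-oneS v) (EGF.sym (compose-shift 1s)) ⟩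
    oneS ⊕ v ⊛ compose 1s v                      ≈⟨ ⊕-congˡ oneS (⊛-congˡ v (EGF.sym geomS-compose)) ⟩
    oneS ⊕ v ⊛ geomS v                           ∎
    where
    open ≗-Reasoning
    1s : ℕ → ℚ
    1s _ = 1ℚ
    one≡δ+shift : ∀ k → 1ℚ ≡ oneS k +ℚ shiftˢ 1s k
    one≡δ+shift zero    = sym (ℚ.+-identityʳ 1ℚ)
    one≡δ+shift (suc k) = sym (ℚ.+-identityˡ 1ℚ)

  geomS-solve : ∀ {y z} → y ≗ z ⊕ v ⊛ y → y ≗ geomS v ⊛ z
  geomS-solve {y} {z} y≗z+vy = +-cancelʳ (G ⊛ (v ⊛ y)) y (G ⊛ z) (begin
    y ⊕ G ⊛ (v ⊛ y)              ≈⟨ ⊕-congˡ y (xy∙z≈y∙xz v G y) ⟨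
    y ⊕ (v ⊛ G) ⊛ y              ≈⟨ ⊕-congʳ ((v ⊛ G) ⊛ y) (⊛-identityˡ y) ⟨
    oneS ⊛ y ⊕ (v ⊛ G) ⊛ y       ≈⟨ ⊛-distribʳ y oneS (v ⊛ G) ⟨
    (oneS ⊕ v ⊛ G) ⊛ y           ≈⟨ ⊛-congʳ y geomS-unfold ⟨
    G ⊛ y                        ≈⟨ ⊛-congˡ G y≗z+vy ⟩
    G ⊛ (z ⊕ v ⊛ y)              ≈⟨ ⊛-distribˡ G z (v ⊛ y) ⟩
    G ⊛ z ⊕ G ⊛ (v ⊛ y)          ∎)
    where
    open ≗-Reasoning
    G = geomS v

  D-geomS : D (geomS v) ≗ geomS v ⊛ (D v ⊛ geomS v)
  D-geomS = geomS-solve {D (geomS v)} {D v ⊛ geomS v} λ n → begin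
    geomS v (suc n)                                      ≡⟨ geomS-unfold (suc n) ⟩
    0ℚ +ℚ (v ⊛ geomS v) (suc n)                          ≡⟨ ℚ.+-identityˡ _ ⟩
    (v ⊛ geomS v) (suc n)                                ≡⟨ D-⊛ v (geomS v) n ⟩
    (D v ⊛ geomS v) n +ℚ (v ⊛ D (geomS v)) n             ∎
    where open ≡-Reasoning

-- Degenerate exponentials and Stirling numbers

module _ (lam : ℚ) where

  D-expλ : ∀ x → D (expλ lam x) ≗ scaleS x (expλ lam (x - lam))
  D-expλ x zero    = shift-first x lam
    where
    shift-first : ∀ x l → 1ℚ * (x - 0ℚ * l) ≡ x * 1ℚ
    shift-first = solve-∀ ℚ-ring
  D-expλ x (suc n) = begin
    ff lam x (suc n) * (x - ι (suc n) * lam)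
      ≡⟨ cong (_* (x - ι (suc n) * lam)) (D-expλ x n) ⟩
    x * ff lam (x - lam) n * (x - ι (suc n) * lam)
      ≡⟨ cong (λ i → x * ff lam (x - lam) n * (x - i * lam)) (ι-suc n) ⟩
    x * ff lam (x - lam) n * (x - (1ℚ +ℚ ι n) * lam)
      ≡⟨ shift-factor x (ff lam (x - lam) n) (ι n) lam ⟩
    x * (ff lam (x - lam) n * ((x - lam) - ι n * lam))
      ∎
    where
    open ≡-Reasoning
    shift-factor : ∀ x f i l → x * f * (x - (1ℚ +ℚ i) * l) ≡ x * (f * ((x - l) - i * l))
    shift-factor = solve-∀ ℚ-ring

  expλ-0 : expλ lam 0ℚ ≗ oneS
  expλ-0 zero    = refl
  expλ-0 (suc n) = trans (D-expλ 0ℚ n) (ℚ.*-zeroˡ (ff lam (0ℚ - lam) n))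

  expλ-+ : ∀ x y → expλ lam x ⊛ expλ lam y ≗ expλ lam (x +ℚ y)
  expλ-+ x y zero    = ℚ.*-identityˡ (1ℚ * 1ℚ)
  expλ-+ x y (suc n) = begin
    (E x ⊛ E y) (suc n)
      ≡⟨ D-⊛ (E x) (E y) n ⟩
    (D (E x) ⊛ E y) n +ℚ (E x ⊛ D (E y)) n
      ≡⟨ cong₂ _+ℚ_ (trans (⊛-congʳ (E y) (D-expλ x) n) (⊛-scaleˡ x (E (x - lam)) (E y) n))
                    (trans (⊛-congˡ (E x) (D-expλ y) n) (⊛-scaleʳ y (E x) (E (y - lam)) n)) ⟩
    x * (E (x - lam) ⊛ E y) n +ℚ y * (E x ⊛ E (y - lam)) n
      ≡⟨ cong₂ (λ a b → x * a +ℚ y * b)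
               (trans (expλ-+ (x - lam) y n) (cong (λ z → E z n) (sub-+ˡ x y lam)))
               (trans (expλ-+ x (y - lam) n) (cong (λ z → E z n) (sub-+ʳ x y lam))) ⟩
    x * E ((x +ℚ y) - lam) n +ℚ y * E ((x +ℚ y) - lam) n
      ≡⟨ ℚ.*-distribʳ-+ (E ((x +ℚ y) - lam) n) x y ⟨
    (x +ℚ y) * E ((x +ℚ y) - lam) n
      ≡⟨ D-expλ (x +ℚ y) n ⟨
    E (x +ℚ y) (suc n) ∎
    where
    open ≡-Reasoning
    E : ℚ → EGF
    E = expλ lam
    sub-+ˡ : ∀ x y l → (x - l) +ℚ y ≡ (x +ℚ y) - l
    sub-+ˡ = solve-∀ ℚ-ring
    sub-+ʳ : ∀ x y l → x +ℚ (y - l) ≡ (x +ℚ y) - l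
    sub-+ʳ = solve-∀ ℚ-ring

  D-expλm1 : D (expλm1 lam) ≗ expλ lam (1ℚ - lam)
  D-expλm1 n = trans (D-expλ 1ℚ n) (ℚ.*-identityˡ (ff lam (1ℚ - lam) n))

  expλm1-euler : D (expλm1 lam) ⊕ scaleS lam (X ⊛ D (expλm1 lam)) ≗ oneS ⊕ expλm1 lam
  expλm1-euler n = trans (cong (λ x → expλm1 lam (suc n) +ℚ lam * x) (X-⊛-D (expλm1 lam) n)) (pointwise n)
    where
    at-zero : ∀ l → 1ℚ * (1ℚ - 0ℚ * l) +ℚ l * (0ℚ * 0ℚ) ≡ 1ℚ +ℚ 0ℚ
    at-zero = solve-∀ ℚ-ring
    at-suc : ∀ f i l → f * (1ℚ - i * l) +ℚ l * (i * f) ≡ 0ℚ +ℚ f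
    at-suc = solve-∀ ℚ-ring
    pointwise : ∀ n → expλm1 lam (suc n) +ℚ lam * (ι n * expλm1 lam n) ≡ oneS n +ℚ expλm1 lam n
    pointwise zero    = at-zero lam
    pointwise (suc n) = at-suc (ff lam 1ℚ (suc n)) (ι (suc n)) lam

  powS-expλm1-euler : ∀ j → D (powS (expλm1 lam) (suc j)) ⊕ scaleS lam (X ⊛ D (powS (expλm1 lam) (suc j)))
                          ≗ scaleS (ι (suc j)) (powS (expλm1 lam) j ⊛ (oneS ⊕ expλm1 lam))
  powS-expλm1-euler j = begin
    D uʲ⁺¹ ⊕ scaleS lam (X ⊛ D uʲ⁺¹)
      ≈⟨ EGF.+-cong (D-powS u j) (scaleS-cong lam (⊛-congˡ X (D-powS u j))) ⟩
    scaleS c (uʲ ⊛ D u) ⊕ scaleS lam (X ⊛ scaleS c (uʲ ⊛ D u))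
      ≈⟨ ⊕-congˡ (scaleS c (uʲ ⊛ D u)) (scaleS-cong lam
           (EGF.trans (⊛-scaleʳ c X (uʲ ⊛ D u)) (scaleS-cong c (x∙yz≈y∙xz X uʲ (D u))))) ⟩
    scaleS c (uʲ ⊛ D u) ⊕ scaleS lam (scaleS c (uʲ ⊛ (X ⊛ D u)))
      ≈⟨ (λ n → factor-out c lam ((uʲ ⊛ D u) n) ((uʲ ⊛ (X ⊛ D u)) n)) ⟩
    scaleS c (uʲ ⊛ D u ⊕ scaleS lam (uʲ ⊛ (X ⊛ D u)))
      ≈⟨ scaleS-cong c (⊕-congˡ (uʲ ⊛ D u) (⊛-scaleʳ lam uʲ (X ⊛ D u))) ⟨
    scaleS c (uʲ ⊛ D u ⊕ uʲ ⊛ scaleS lam (X ⊛ D u))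
      ≈⟨ scaleS-cong c (⊛-distribˡ uʲ (D u) (scaleS lam (X ⊛ D u))) ⟨
    scaleS c (uʲ ⊛ (D u ⊕ scaleS lam (X ⊛ D u)))
      ≈⟨ scaleS-cong c (⊛-congˡ uʲ (expλm1-euler)) ⟩
    scaleS c (uʲ ⊛ (oneS ⊕ u))
      ∎
    where
    open ≗-Reasoning
    u = expλm1 lam
    uʲ = powS u j
    uʲ⁺¹ = powS u (suc j)
    c = ι (suc j)
    factor-out : ∀ c l a b → c * a +ℚ l * (c * b) ≡ c * (a +ℚ l * b)
    factor-out = solve-∀ ℚ-ring

  stirling2-suc : ∀ m k → stirling2 lam (suc m) k
                          ≡ shiftˢ (stirling2 lam m) k +ℚ (ι k - ι m * lam) * stirling2 lam m k
  stirling2-suc zero    zero    = at-zero lam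
    where
    at-zero : ∀ l → 0ℚ * 1ℚ ≡ 0ℚ +ℚ (0ℚ - 0ℚ * l) * (1ℚ * 1ℚ)
    at-zero = solve-∀ ℚ-ring
  stirling2-suc (suc m) zero    = at-zero lam (ι (suc m))
    where
    at-zero : ∀ l i → 0ℚ * 1ℚ ≡ 0ℚ +ℚ (0ℚ - i * l) * (0ℚ * 1ℚ)
    at-zero = solve-∀ ℚ-ring
  stirling2-suc m       (suc j) = begin
    uʲ⁺¹ (suc m) * suc j !⁻¹
      ≡⟨ cong (_* suc j !⁻¹) (add-sub (uʲ⁺¹ (suc m)) (lam * (ι m * uʲ⁺¹ m))) ⟩
    ((uʲ⁺¹ (suc m) +ℚ lam * (ι m * uʲ⁺¹ m)) - lam * (ι m * uʲ⁺¹ m)) * suc j !⁻¹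
      ≡⟨ cong (λ x → (x - lam * (ι m * uʲ⁺¹ m)) * suc j !⁻¹) euler-coefficient ⟩
    (ι (suc j) * (uʲ m +ℚ uʲ⁺¹ m) - lam * (ι m * uʲ⁺¹ m)) * suc j !⁻¹
      ≡⟨ regroup (ι (suc j)) (uʲ m) (uʲ⁺¹ m) lam (ι m) (suc j !⁻¹) ⟩
    (ι (suc j) * suc j !⁻¹) * uʲ m +ℚ (ι (suc j) - ι m * lam) * (uʲ⁺¹ m * suc j !⁻¹)
      ≡⟨ cong (λ x → x * uʲ m +ℚ (ι (suc j) - ι m * lam) * (uʲ⁺¹ m * suc j !⁻¹)) (ι-suc-*-!⁻¹ j) ⟩
    j !⁻¹ * uʲ m +ℚ (ι (suc j) - ι m * lam) * (uʲ⁺¹ m * suc j !⁻¹)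
      ≡⟨ cong (_+ℚ (ι (suc j) - ι m * lam) * (uʲ⁺¹ m * suc j !⁻¹)) (ℚ.*-comm (j !⁻¹) (uʲ m)) ⟩
    uʲ m * j !⁻¹ +ℚ (ι (suc j) - ι m * lam) * (uʲ⁺¹ m * suc j !⁻¹)
      ∎
    where
    open ≡-Reasoning
    u = expλm1 lam
    uʲ = powS u j
    uʲ⁺¹ = powS u (suc j)
    add-sub : ∀ x y → x ≡ (x +ℚ y) - y
    add-sub = solve-∀ ℚ-ring
    regroup : ∀ c a b l i r → (c * (a +ℚ b) - l * (i * b)) * r ≡ (c * r) * a +ℚ (c - i * l) * (b * r)
    regroup = solve-∀ ℚ-ring
    euler-coefficient : uʲ⁺¹ (suc m) +ℚ lam * (ι m * uʲ⁺¹ m) ≡ ι (suc j) * (uʲ m +ℚ uʲ⁺¹ m)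
    euler-coefficient = begin
      uʲ⁺¹ (suc m) +ℚ lam * (ι m * uʲ⁺¹ m)
        ≡⟨ cong (λ x → uʲ⁺¹ (suc m) +ℚ lam * x) (X-⊛-D uʲ⁺¹ m) ⟨
      uʲ⁺¹ (suc m) +ℚ lam * (X ⊛ D uʲ⁺¹) m
        ≡⟨ powS-expλm1-euler j m ⟩
      ι (suc j) * (uʲ ⊛ (oneS ⊕ u)) m
        ≡⟨ cong (ι (suc j) *_) (⊛-distribˡ uʲ oneS u m) ⟩
      ι (suc j) * ((uʲ ⊛ oneS) m +ℚ uʲ⁺¹ m)
        ≡⟨ cong (λ x → ι (suc j) * (x +ℚ uʲ⁺¹ m)) (EGF.*-identityʳ uʲ m) ⟩
      ι (suc j) * (uʲ m +ℚ uʲ⁺¹ m)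
        ∎

  stirling2-vanish : ∀ m → stirling2 lam m (suc m) ≡ 0ℚ
  stirling2-vanish m = trans (cong (_* suc m !⁻¹) (powS-vanish (expλm1 lam) refl (suc m) m (ℕ.n<1+n m)))
                             (ℚ.*-zeroˡ (suc m !⁻¹))

-- The Bell series and its derivatives

module BellSeries (lam t : ℚ) where

  c : ℚ
  c = - lam * t

  u v G B e₁ : EGF
  u = expλm1 lam
  v = scaleS c u
  G = geomS v
  B n = bel lam n t
  e₁ = expλ lam (1ℚ - lam)

  v₀≡0 : v 0 ≡ 0ℚ
  v₀≡0 = ℚ.*-zeroʳ c

  bel-coefficient : ℕ → ℚ
  bel-coefficient k = k !⁻¹ * (ff lam 1ℚ k * t ^ᵠ k)

  bel-compose : B ≗ compose bel-coefficient u
  bel-compose n = sumTo-cong n (λ k _ → rearrange (powS u k n) (k !⁻¹) (ff lam 1ℚ k) (t ^ᵠ k))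
    where
    rearrange : ∀ p r f T → p * r * f * T ≡ r * (f * T) * p
    rearrange = solve-∀ ℚ-ring

  derivˢ-bel-coefficient : ∀ k → derivˢ bel-coefficient k
                                 ≡ t * bel-coefficient k +ℚ c * shiftˢ (derivˢ bel-coefficient) k
  derivˢ-bel-coefficient k = begin
    ι (suc k) * (suc k !⁻¹ * (ff lam 1ℚ k * (1ℚ - ι k * lam) * (t ^ᵠ k * t)))
      ≡⟨ ℚ.*-assoc (ι (suc k)) (suc k !⁻¹) _ ⟨
    (ι (suc k) * suc k !⁻¹) * (ff lam 1ℚ k * (1ℚ - ι k * lam) * (t ^ᵠ k * t))
      ≡⟨ cong (_* (ff lam 1ℚ k * (1ℚ - ι k * lam) * (t ^ᵠ k * t))) (ι-suc-*-!⁻¹ k) ⟩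
    k !⁻¹ * (ff lam 1ℚ k * (1ℚ - ι k * lam) * (t ^ᵠ k * t))
      ≡⟨ expand (k !⁻¹) (ff lam 1ℚ k) (ι k) lam (t ^ᵠ k) t ⟩
    t * bel-coefficient k +ℚ c * (ι k * bel-coefficient k)
      ≡⟨ cong (λ x → t * bel-coefficient k +ℚ c * x) (shiftˢ-derivˢ bel-coefficient k) ⟨
    t * bel-coefficient k +ℚ c * shiftˢ (derivˢ bel-coefficient) k
      ∎
    where
    open ≡-Reasoning
    expand : ∀ r f i l T t → r * (f * (1ℚ - i * l) * (T * t))
                             ≡ t * (r * (f * T)) +ℚ (- l * t) * (i * (r * (f * T)))
    expand = solve-∀ ℚ-ring

  D-bel : D B ≗ scaleS t (G ⊛ (e₁ ⊛ B))
  D-bel = EGF.trans (geomS-solve v v₀≡0 {D B} {scaleS t (e₁ ⊛ B)} D-bel-equation) (⊛-scaleʳ t G (e₁ ⊛ B))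
    where
    open ≗-Reasoning
    Q Q′ : ℕ → ℚ
    Q = bel-coefficient
    Q′ = derivˢ bel-coefficient
    D-expλm1-⊛-compose : D u ⊛ compose Q u ≗ e₁ ⊛ B
    D-expλm1-⊛-compose = EGF.trans (⊛-congʳ (compose Q u) (D-expλm1 lam)) (⊛-congˡ e₁ (EGF.sym bel-compose))
    D-bel-compose : D B ≗ D u ⊛ compose Q′ u
    D-bel-compose = EGF.trans (λ n → bel-compose (suc n)) (D-compose u refl Q)
    Q′-split : compose Q′ u ≗ scaleS t (compose Q u) ⊕ scaleS c (u ⊛ compose Q′ u)
    Q′-split = begin
      compose Q′ u
        ≈⟨ compose-cong u derivˢ-bel-coefficient ⟩
      compose (λ k → t * Q k +ℚ c * shiftˢ Q′ k) u
        ≈⟨ compose-+ (λ k → t * Q k) (λ k → c * shiftˢ Q′ k) u ⟩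
      compose (λ k → t * Q k) u ⊕ compose (λ k → c * shiftˢ Q′ k) u
        ≈⟨ EGF.+-cong (compose-scale t Q u) (compose-scale c (shiftˢ Q′) u) ⟩
      scaleS t (compose Q u) ⊕ scaleS c (compose (shiftˢ Q′) u)
        ≈⟨ ⊕-congˡ (scaleS t (compose Q u)) (scaleS-cong c (compose-shift u refl Q′)) ⟨
      scaleS t (compose Q u) ⊕ scaleS c (u ⊛ compose Q′ u)
        ∎
    D-bel-equation : D B ≗ scaleS t (e₁ ⊛ B) ⊕ v ⊛ D B
    D-bel-equation = begin
      D B
        ≈⟨ D-bel-compose ⟩
      D u ⊛ compose Q′ u
        ≈⟨ ⊛-congˡ (D u) Q′-split ⟩
      D u ⊛ (scaleS t (compose Q u) ⊕ scaleS c (u ⊛ compose Q′ u))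
        ≈⟨ ⊛-distribˡ (D u) (scaleS t (compose Q u)) (scaleS c (u ⊛ compose Q′ u)) ⟩
      D u ⊛ scaleS t (compose Q u) ⊕ D u ⊛ scaleS c (u ⊛ compose Q′ u)
        ≈⟨ EGF.+-cong (⊛-scaleʳ t (D u) (compose Q u)) (⊛-scaleʳ c (D u) (u ⊛ compose Q′ u)) ⟩
      scaleS t (D u ⊛ compose Q u) ⊕ scaleS c (D u ⊛ (u ⊛ compose Q′ u))
        ≈⟨ EGF.+-cong (scaleS-cong t D-expλm1-⊛-compose) (scaleS-cong c (x∙yz≈y∙xz (D u) u (compose Q′ u))) ⟩
      scaleS t (e₁ ⊛ B) ⊕ scaleS c (u ⊛ (D u ⊛ compose Q′ u))
        ≈⟨ ⊕-congˡ (scaleS t (e₁ ⊛ B)) (⊛-scaleˡ c u (D u ⊛ compose Q′ u)) ⟨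
      scaleS t (e₁ ⊛ B) ⊕ v ⊛ (D u ⊛ compose Q′ u)
        ≈⟨ ⊕-congˡ (scaleS t (e₁ ⊛ B)) (⊛-congˡ v D-bel-compose) ⟨
      scaleS t (e₁ ⊛ B) ⊕ v ⊛ D B
        ∎

  D-geomS-bell : D G ≗ scaleS c (G ⊛ (e₁ ⊛ G))
  D-geomS-bell = begin
    D G                          ≈⟨ D-geomS v v₀≡0 ⟩
    G ⊛ (D v ⊛ G)                ≈⟨ ⊛-congˡ G (⊛-scaleˡ c (D u) G) ⟩
    G ⊛ scaleS c (D u ⊛ G)       ≈⟨ ⊛-scaleʳ c G (D u ⊛ G) ⟩
    scaleS c (G ⊛ (D u ⊛ G))     ≈⟨ scaleS-cong c (⊛-congˡ G (⊛-congʳ G (D-expλm1 lam))) ⟩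
    scaleS c (G ⊛ (e₁ ⊛ G))      ∎
    where open ≗-Reasoning

  D-powS-geomS : ∀ j → D (powS G j) ≗ scaleS (ι j * c) (powS G (suc j) ⊛ e₁)
  D-powS-geomS zero    n = sym (trans (cong (_* (powS G 1 ⊛ e₁) n) (ℚ.*-zeroˡ c))
                                     (ℚ.*-zeroˡ ((powS G 1 ⊛ e₁) n)))
  D-powS-geomS (suc k) = begin
    D (powS G (suc k))
      ≈⟨ D-powS G k ⟩
    scaleS (ι (suc k)) (Gᵏ ⊛ D G)
      ≈⟨ scaleS-cong (ι (suc k)) (⊛-congˡ Gᵏ D-geomS-bell) ⟩
    scaleS (ι (suc k)) (Gᵏ ⊛ scaleS c (G ⊛ (e₁ ⊛ G)))
      ≈⟨ scaleS-cong (ι (suc k)) (⊛-scaleʳ c Gᵏ (G ⊛ (e₁ ⊛ G))) ⟩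
    scaleS (ι (suc k)) (scaleS c (Gᵏ ⊛ (G ⊛ (e₁ ⊛ G))))
      ≈⟨ scaleS-scaleS (ι (suc k)) c (Gᵏ ⊛ (G ⊛ (e₁ ⊛ G))) ⟩
    scaleS (ι (suc k) * c) (Gᵏ ⊛ (G ⊛ (e₁ ⊛ G)))
      ≈⟨ scaleS-cong (ι (suc k) * c) (⊛-assoc Gᵏ G (e₁ ⊛ G)) ⟨
    scaleS (ι (suc k) * c) (powS G (suc k) ⊛ (e₁ ⊛ G))
      ≈⟨ scaleS-cong (ι (suc k) * c) (x∙yz≈xz∙y (powS G (suc k)) e₁ G) ⟩
    scaleS (ι (suc k) * c) (powS G (suc (suc k)) ⊛ e₁)
      ∎
    where
    open ≗-Reasoning
    Gᵏ = powS G k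

  e₁-⊛-expλ : ∀ z → e₁ ⊛ expλ lam z ≗ expλ lam (z +ℚ (1ℚ - lam))
  e₁-⊛-expλ z n = trans (expλ-+ lam (1ℚ - lam) z n) (cong (λ w → ff lam w n) (ℚ.+-comm (1ℚ - lam) z))

  -- F j z = Σ_n F^{(j)}_{n,λ}(-λt, z) sⁿ/n!
  F : ℕ → ℚ → EGF
  F j z = powS G j ⊛ expλ lam z

  D-fubini : ∀ j z → D (F j z) ≗ scaleS (ι j * c) (F (suc j) (z +ℚ (1ℚ - lam))) ⊕ scaleS z (F j (z - lam))
  D-fubini j z = begin
    D (powS G j ⊛ E z)
      ≈⟨ D-⊛ (powS G j) (E z) ⟩
    D (powS G j) ⊛ E z ⊕ powS G j ⊛ D (E z)
      ≈⟨ EGF.+-cong (⊛-congʳ (E z) (D-powS-geomS j)) (⊛-congˡ (powS G j) (D-expλ lam z)) ⟩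
    scaleS (ι j * c) (powS G (suc j) ⊛ e₁) ⊛ E z ⊕ powS G j ⊛ scaleS z (E (z - lam))
      ≈⟨ EGF.+-cong (⊛-scaleˡ (ι j * c) (powS G (suc j) ⊛ e₁) (E z)) (⊛-scaleʳ z (powS G j) (E (z - lam))) ⟩
    scaleS (ι j * c) ((powS G (suc j) ⊛ e₁) ⊛ E z) ⊕ scaleS z (F j (z - lam))
      ≈⟨ ⊕-congʳ (scaleS z (F j (z - lam))) (scaleS-cong (ι j * c)
           (EGF.trans (⊛-assoc (powS G (suc j)) e₁ (E z)) (⊛-congˡ (powS G (suc j)) (e₁-⊛-expλ z)))) ⟩
    scaleS (ι j * c) (F (suc j) (z +ℚ (1ℚ - lam))) ⊕ scaleS z (F j (z - lam))
      ∎
    where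
    open ≗-Reasoning
    E : ℚ → EGF
    E = expλ lam

  D-bel-⊛-fubini : ∀ j z → D B ⊛ F j z ≗ scaleS t (B ⊛ F (suc j) (z +ℚ (1ℚ - lam)))
  D-bel-⊛-fubini j z = begin
    D B ⊛ (Gʲ ⊛ E)
      ≈⟨ ⊛-congʳ (Gʲ ⊛ E) D-bel ⟩
    scaleS t (G ⊛ (e₁ ⊛ B)) ⊛ (Gʲ ⊛ E)
      ≈⟨ ⊛-scaleˡ t (G ⊛ (e₁ ⊛ B)) (Gʲ ⊛ E) ⟩
    scaleS t ((G ⊛ (e₁ ⊛ B)) ⊛ (Gʲ ⊛ E))
      ≈⟨ scaleS-cong t rearrange ⟩
    scaleS t (B ⊛ ((Gʲ ⊛ G) ⊛ (e₁ ⊛ E)))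
      ≈⟨ scaleS-cong t (⊛-congˡ B (⊛-congˡ (Gʲ ⊛ G) (e₁-⊛-expλ z))) ⟩
    scaleS t (B ⊛ F (suc j) (z +ℚ (1ℚ - lam)))
      ∎
    where
    open ≗-Reasoning
    Gʲ = powS G j
    E = expλ lam z
    rearrange : (G ⊛ (e₁ ⊛ B)) ⊛ (Gʲ ⊛ E) ≗ B ⊛ ((Gʲ ⊛ G) ⊛ (e₁ ⊛ E))
    rearrange = begin
      (G ⊛ (e₁ ⊛ B)) ⊛ (Gʲ ⊛ E)      ≈⟨ ⊛-congʳ (Gʲ ⊛ E) (x∙yz≈z∙xy G e₁ B) ⟩
      (B ⊛ (G ⊛ e₁)) ⊛ (Gʲ ⊛ E)      ≈⟨ ⊛-assoc B (G ⊛ e₁) (Gʲ ⊛ E) ⟩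
      B ⊛ ((G ⊛ e₁) ⊛ (Gʲ ⊛ E))      ≈⟨ ⊛-congˡ B (interchange G e₁ Gʲ E) ⟩
      B ⊛ ((G ⊛ Gʲ) ⊛ (e₁ ⊛ E))      ≈⟨ ⊛-congˡ B (⊛-congʳ (e₁ ⊛ E) (⊛-comm G Gʲ)) ⟩
      B ⊛ ((Gʲ ⊛ G) ⊛ (e₁ ⊛ E))      ∎

  T : ℕ → ℚ → EGF
  T j z = B ⊛ F j z

  D-T : ∀ j z → D (T j z) ≗ scaleS (t +ℚ ι j * c) (T (suc j) (z +ℚ (1ℚ - lam))) ⊕ scaleS z (T j (z - lam))
  D-T j z = begin
    D (B ⊛ F j z)
      ≈⟨ D-⊛ B (F j z) ⟩
    D B ⊛ F j z ⊕ B ⊛ D (F j z)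
      ≈⟨ EGF.+-cong (D-bel-⊛-fubini j z) (⊛-congˡ B (D-fubini j z)) ⟩
    scaleS t T′ ⊕ B ⊛ (scaleS (ι j * c) F′ ⊕ scaleS z F″)
      ≈⟨ ⊕-congˡ (scaleS t T′) (⊛-distribˡ B (scaleS (ι j * c) F′) (scaleS z F″)) ⟩
    scaleS t T′ ⊕ (B ⊛ scaleS (ι j * c) F′ ⊕ B ⊛ scaleS z F″)
      ≈⟨ ⊕-congˡ (scaleS t T′) (EGF.+-cong (⊛-scaleʳ (ι j * c) B F′) (⊛-scaleʳ z B F″)) ⟩
    scaleS t T′ ⊕ (scaleS (ι j * c) T′ ⊕ scaleS z T″)
      ≈⟨ (λ n → regroup t (ι j * c) (T′ n) z (T″ n)) ⟩
    scaleS (t +ℚ ι j * c) T′ ⊕ scaleS z T″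
      ∎
    where
    open ≗-Reasoning
    F′ = F (suc j) (z +ℚ (1ℚ - lam))
    F″ = F j (z - lam)
    T′ = T (suc j) (z +ℚ (1ℚ - lam))
    T″ = T j (z - lam)
    regroup : ∀ t a x z y → t * x +ℚ (a * x +ℚ z * y) ≡ (t +ℚ a) * x +ℚ z * y
    regroup = solve-∀ ℚ-ring

  weight : ℕ → ℕ → ℚ
  weight m k = ff lam 1ℚ k * stirling2 lam m k * t ^ᵠ k

  order : ℕ → ℕ → ℚ
  order m k = ι k - ι m * lam

  -- The n-th coefficient of expansion m is the right-hand side of the theorem.
  expansion : ℕ → EGF
  expansion m n = sumTo m (λ k → weight m k * T k (order m k) n)

  weight-suc : ∀ m k → weight (suc m) k
                       ≡ shiftˢ (λ j → weight m j * (t +ℚ ι j * c)) k +ℚ weight m k * order m k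
  weight-suc m k = trans (cong (λ s → ff lam 1ℚ k * s * t ^ᵠ k) (stirling2-suc lam m k)) (regroup k)
    where
    S : ℕ → ℚ
    S = stirling2 lam m
    at-zero : ∀ s y → 1ℚ * (0ℚ +ℚ y * s) * 1ℚ ≡ 0ℚ +ℚ 1ℚ * s * 1ℚ * y
    at-zero = solve-∀ ℚ-ring
    at-suc : ∀ f i l s₀ s₁ y T t → f * (1ℚ - i * l) * (s₀ +ℚ y * s₁) * (T * t)
                                   ≡ f * s₀ * T * (t +ℚ i * (- l * t)) +ℚ f * (1ℚ - i * l) * s₁ * (T * t) * y
    at-suc = solve-∀ ℚ-ring
    regroup : ∀ k → ff lam 1ℚ k * (shiftˢ S k +ℚ order m k * S k) * t ^ᵠ k
                    ≡ shiftˢ (λ j → weight m j * (t +ℚ ι j * c)) k +ℚ weight m k * order m k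
    regroup zero    = at-zero (S 0) (order m 0)
    regroup (suc j) = at-suc (ff lam 1ℚ j) (ι j) lam (S j) (S (suc j)) (order m (suc j)) (t ^ᵠ j) t

  weight-vanish : ∀ m → weight m (suc m) ≡ 0ℚ
  weight-vanish m = begin
    ff lam 1ℚ (suc m) * stirling2 lam m (suc m) * t ^ᵠ suc m
      ≡⟨ cong (λ s → ff lam 1ℚ (suc m) * s * t ^ᵠ suc m) (stirling2-vanish lam m) ⟩
    ff lam 1ℚ (suc m) * 0ℚ * t ^ᵠ suc m
      ≡⟨ cong (_* t ^ᵠ suc m) (ℚ.*-zeroʳ (ff lam 1ℚ (suc m))) ⟩
    0ℚ * t ^ᵠ suc m
      ≡⟨ ℚ.*-zeroˡ (t ^ᵠ suc m) ⟩
    0ℚ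
      ∎
    where open ≡-Reasoning

  order-suc-suc : ∀ m k → order m k +ℚ (1ℚ - lam) ≡ order (suc m) (suc k)
  order-suc-suc m k = trans (shift (ι k) (ι m) lam) (sym (cong₂ (λ i j → i - j * lam) (ι-suc k) (ι-suc m)))
    where
    shift : ∀ i j l → (i - j * l) +ℚ (1ℚ - l) ≡ (1ℚ +ℚ i) - (1ℚ +ℚ j) * l
    shift = solve-∀ ℚ-ring

  order-suc : ∀ m k → order m k - lam ≡ order (suc m) k
  order-suc m k = trans (shift (ι k) (ι m) lam) (sym (cong (λ j → ι k - j * lam) (ι-suc m)))
    where
    shift : ∀ i j l → (i - j * l) - l ≡ i - (1ℚ +ℚ j) * l
    shift = solve-∀ ℚ-ring

  D-expansion : ∀ m → D (expansion m) ≗ expansion (suc m)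
  D-expansion m n = begin
    sumTo m (λ k → weight m k * T k (order m k) (suc n))
      ≡⟨ sumTo-cong m (λ k _ → D-term k) ⟩
    sumTo m (λ k → α k * T′ (suc k) +ℚ β k * T′ k)
      ≡⟨ sumTo-distrib-+ m (λ k → α k * T′ (suc k)) (λ k → β k * T′ k) ⟩
    sumTo m (λ k → α k * T′ (suc k)) +ℚ sumTo m (λ k → β k * T′ k)
      ≡⟨ cong₂ _+ℚ_ shifted padded ⟩
    sumTo (suc m) (λ k → shiftˢ α k * T′ k) +ℚ sumTo (suc m) (λ k → β k * T′ k)
      ≡⟨ sumTo-distrib-+ (suc m) (λ k → shiftˢ α k * T′ k) (λ k → β k * T′ k) ⟨
    sumTo (suc m) (λ k → shiftˢ α k * T′ k +ℚ β k * T′ k)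
      ≡⟨ sumTo-cong (suc m) (λ k _ → trans (sym (ℚ.*-distribʳ-+ (T′ k) (shiftˢ α k) (β k)))
                                           (cong (_* T′ k) (sym (weight-suc m k)))) ⟩
    expansion (suc m) n
      ∎
    where
    open ≡-Reasoning
    α β T′ : ℕ → ℚ
    α k = weight m k * (t +ℚ ι k * c)
    β k = weight m k * order m k
    T′ k = T k (order (suc m) k) n
    distribute : ∀ w a x y z → w * (a * x +ℚ y * z) ≡ w * a * x +ℚ w * y * z
    distribute = solve-∀ ℚ-ring
    D-term : ∀ k → weight m k * T k (order m k) (suc n) ≡ α k * T′ (suc k) +ℚ β k * T′ k
    D-term k = begin
      weight m k * T k (order m k) (suc n)
        ≡⟨ cong (weight m k *_) (D-T k (order m k) n) ⟩
      weight m k * ((t +ℚ ι k * c) * T (suc k) (order m k +ℚ (1ℚ - lam)) n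
                    +ℚ order m k * T k (order m k - lam) n)
        ≡⟨ cong₂ (λ p q → weight m k * ((t +ℚ ι k * c) * T (suc k) p n +ℚ order m k * T k q n))
                 (order-suc-suc m k) (order-suc m k) ⟩
      weight m k * ((t +ℚ ι k * c) * T′ (suc k) +ℚ order m k * T′ k)
        ≡⟨ distribute (weight m k) (t +ℚ ι k * c) (T′ (suc k)) (order m k) (T′ k) ⟩
      α k * T′ (suc k) +ℚ β k * T′ k
        ∎
    shifted : sumTo m (λ k → α k * T′ (suc k)) ≡ sumTo (suc m) (λ k → shiftˢ α k * T′ k)
    shifted = sym (begin
      sumTo (suc m) (λ k → shiftˢ α k * T′ k)
        ≡⟨ sumTo-suc m (λ k → shiftˢ α k * T′ k) ⟩
      0ℚ * T′ 0 +ℚ sumTo m (λ k → α k * T′ (suc k))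
        ≡⟨ cong (_+ℚ sumTo m (λ k → α k * T′ (suc k))) (ℚ.*-zeroˡ (T′ 0)) ⟩
      0ℚ +ℚ sumTo m (λ k → α k * T′ (suc k))
        ≡⟨ ℚ.+-identityˡ _ ⟩
      sumTo m (λ k → α k * T′ (suc k))
        ∎)
    β-vanish : β (suc m) * T′ (suc m) ≡ 0ℚ
    β-vanish = begin
      weight m (suc m) * order m (suc m) * T′ (suc m)
        ≡⟨ cong (λ w → w * order m (suc m) * T′ (suc m)) (weight-vanish m) ⟩
      0ℚ * order m (suc m) * T′ (suc m)
        ≡⟨ cong (_* T′ (suc m)) (ℚ.*-zeroˡ (order m (suc m))) ⟩
      0ℚ * T′ (suc m)
        ≡⟨ ℚ.*-zeroˡ (T′ (suc m)) ⟩
      0ℚ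
        ∎
    padded : sumTo m (λ k → β k * T′ k) ≡ sumTo (suc m) (λ k → β k * T′ k)
    padded = sym (trans (cong (sumTo m (λ k → β k * T′ k) +ℚ_) β-vanish) (ℚ.+-identityʳ _))

  expansion-zero : expansion 0 ≗ B
  expansion-zero n = begin
    1ℚ * T 0 (order 0 0) n                   ≡⟨ ℚ.*-identityˡ (T 0 (order 0 0) n) ⟩
    (B ⊛ (oneS ⊛ expλ lam (order 0 0))) n    ≡⟨ ⊛-congˡ B (⊛-identityˡ (expλ lam (order 0 0))) n ⟩
    (B ⊛ expλ lam (order 0 0)) n             ≡⟨ ⊛-congˡ B (λ i → cong (λ z → ff lam z i) (order-0-0 lam)) n ⟩
    (B ⊛ expλ lam 0ℚ) n                      ≡⟨ ⊛-congˡ B (expλ-0 lam) n ⟩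
    (B ⊛ oneS) n                             ≡⟨ EGF.*-identityʳ B n ⟩
    B n                                      ∎
    where
    open ≡-Reasoning
    order-0-0 : ∀ l → 0ℚ - 0ℚ * l ≡ 0ℚ
    order-0-0 = solve-∀ ℚ-ring

  expansion-bel : ∀ m n → expansion m n ≡ B (n + m)
  expansion-bel zero    n = trans (expansion-zero n) (cong B (sym (ℕ.+-identityʳ n)))
  expansion-bel (suc m) n = begin
    expansion (suc m) n     ≡⟨ D-expansion m n ⟨
    expansion m (suc n)     ≡⟨ expansion-bel m (suc n) ⟩
    B (suc n + m)           ≡⟨ cong B (ℕ.+-suc n m) ⟨
    B (n + suc m)           ∎
    where open ≡-Reasoning

-- The identity holds for λ = 0 as well.
theorem2 : (lam : ℚ) → lam ≢ 0ℚ → (m n : ℕ) (t : ℚ) →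
    bel lam (n + m) t ≡
      sumTo m (λ k → sumTo n (λ l →
        ff lam 1ℚ k * stirling2 lam m k * ι (n C l) * (t ^ᵠ k)
          * fubini lam k (n ∸ l) (- lam * t) (ι k - ι m * lam)
          * bel lam l t))
theorem2 lam _ m n t = sym (begin
  sumTo m (λ k → sumTo n (λ l → ff lam 1ℚ k * stirling2 lam m k * ι (n C l) * (t ^ᵠ k)
                                  * fubini lam k (n ∸ l) (- lam * t) (order m k) * B l))
    ≡⟨ sumTo-cong m (λ k _ → inner-sum k) ⟩
  expansion m n
    ≡⟨ expansion-bel m n ⟩
  B (n + m)
    ∎)
  where
  open BellSeries lam t
  open ≡-Reasoning
  rearrange : ∀ f s b τ φ β → f * s * b * τ * φ * β ≡ f * s * τ * (b * (β * φ))
  rearrange = solve-∀ ℚ-ring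
  inner-sum : ∀ k → sumTo n (λ l → ff lam 1ℚ k * stirling2 lam m k * ι (n C l) * (t ^ᵠ k)
                                   * fubini lam k (n ∸ l) (- lam * t) (order m k) * B l)
                    ≡ weight m k * T k (order m k) n
  inner-sum k = trans (sumTo-cong n (λ l _ → rearrange (ff lam 1ℚ k) (stirling2 lam m k) (ι (n C l)) (t ^ᵠ k)
                                                       (F k (order m k) (n ∸ l)) (B l)))
                      (sumTo-*-distribˡ n (weight m k) (λ l → ι (n C l) * (B l * F k (order m k) (n ∸ l))))
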